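{- Let $N\ge 2$ and let $(b,d)\in\mathbb{Z}^2$ be primitive with $N\nmid d$. Then there exists a sequence $(v_i)_{i=0}^k$ in $\mathbb{Z}^2$ with the following properties: - $v_0=(0,1)$ and $v_k=(b,d)$; - $v_i\wedge v_{i+1}=1$ for $0\le i<k$; - writing $v_i=(b_i,d_i)$, we have $N\nmid d_i$ for all $0\le i\le k$.
   Context: For $v=(x_1,y_1)$ and $w=(x_2,y_2)$ in $\mathbb{Z}^2$, $v\wedge w=x_1y_2-x_2y_1$. -}

module Defs where

open import Data.Integer using (ℤ; _-_; _*_; +_; 1ℤ)
open import Data.Integer.GCD using (gcd)
open import Data.Product using (_×_; _,_)
open import Relation.Binary.PropositionalEquality using (_≡_)

ℤ² : Set
ℤ² = ℤ × ℤ

_∧_ : ℤ² → ℤ² → ℤ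
(x₁ , y₁) ∧ (x₂ , y₂) = x₁ * y₂ - x₂ * y₁

Primitive : ℤ² → Set
Primitive (b , d) = gcd b d ≡ 1ℤ

-- Euclid's algorithm on the first coordinate. Let u ∧ v = 1 with v = (n , d), n ≥ 2 (for
-- n ≤ -2 negate everything). Subtracting a multiple of v from u gives w = (r , e) with
-- 0 ≤ r < n and still w ∧ v = 1; so does w - v = (r - n , e - d). As N ∤ d, N fails to
-- divide e or e - d, and both r and r - n are smaller than n in absolute value, since
-- r = 0 would force n ∣ 1. So every admissible v has an admissible predecessor whose first
-- coordinate is smaller in absolute value, and the descent ends at (0 , ±1) or (±1 , d),
-- which are joined to (0 , 1) directly.
module Submission where

open import Defs
open import Data.Nat using (ℕ; suc; _≤_)
open import Data.Integer using (ℤ; +_; 0ℤ; 1ℤ)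
open import Data.Integer.Divisibility using (_∣_)
open import Data.Fin using (Fin; zero; fromℕ; inject₁)
open import Data.Product using (Σ; _×_; _,_; proj₂)
open import Relation.Binary.PropositionalEquality using (_≡_)
open import Relation.Nullary using (¬_)

open import Data.Nat using (_<_; _∸_; z≤n; s≤s)
import Data.Nat as ℕ
import Data.Nat.Properties as ℕ
import Data.Nat.Divisibility as ℕ
open import Data.Nat.GCD using (module Bézout; gcd-GCD)
open import Data.Nat.Induction using (<-wellFounded)
open import Data.Integer using (-_; _-_; _+_; _*_; ∣_∣; -[1+_]; -1ℤ)
import Data.Integer.Properties as ℤ
open import Data.Integer.DivMod using (_/ℕ_; _%ℕ_; a≡a%ℕn+[a/ℕn]*n; n%ℕd<d)
import Data.Integer.Divisibility.Signed as Signed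
open import Data.Integer.GCD using (gcd)
open import Data.Integer.Tactic.RingSolver using (solve-∀)
open import Data.Product using (proj₁)
open import Data.Sum using (_⊎_; inj₁; inj₂)
open import Data.Vec.Functional using (_∷_)
open import Function using (_∘_)
open import Induction.WellFounded using (module All)
open import Relation.Binary.Construct.Closure.ReflexiveTransitive using (Star; ε; _◅_; _◅◅_)
import Relation.Binary.Construct.On as On
open import Relation.Binary.PropositionalEquality using (refl; sym; trans; cong; cong₂; subst; module ≡-Reasoning)
open import Relation.Nullary using (Dec; yes; no)
open import Data.Empty using (⊥)

open ≡-Reasoning

negate : ℤ² → ℤ²
negate (x , y) = (- x , - y)

_-[_]_ : ℤ² → ℤ → ℤ² → ℤ²
(x , y) -[ k ] (b , d) = (x - k * b , y - k * d)

∧-sub-multiple : ∀ w k v → (w -[ k ] v) ∧ v ≡ w ∧ v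
∧-sub-multiple (x , y) k (b , d) = identity x y k b d
  where
  identity : ∀ x y k b d → (x - k * b) * d - b * (y - k * d) ≡ x * d - b * y
  identity = solve-∀

negate-∧ : ∀ w v → negate w ∧ v ≡ w ∧ negate v
negate-∧ (x , y) (b , d) = identity x y b d
  where
  identity : ∀ x y b d → (- x) * d - b * (- y) ≡ x * (- d) - (- b) * y
  identity = solve-∀

negate-∧-negate : ∀ w v → negate w ∧ negate v ≡ w ∧ v
negate-∧-negate (x , y) (b , d) = identity x y b d
  where
  identity : ∀ x y b d → (- x) * (- d) - (- b) * (- y) ≡ x * d - b * y
  identity = solve-∀

negate-∧-swap : ∀ v w → negate v ∧ w ≡ w ∧ v
negate-∧-swap (b , d) (x , y) = identity x y b d
  where
  identity : ∀ x y b d → (- b) * y - x * (- d) ≡ x * d - b * y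
  identity = solve-∀

∧-zeroˡ : ∀ y v → (0ℤ , y) ∧ v ≡ - (proj₁ v * y)
∧-zeroˡ y (b , d) = identity y b d
  where
  identity : ∀ y b d → 0ℤ * d - b * y ≡ - (b * y)
  identity = solve-∀

∧-zeroʳ : ∀ w d → w ∧ (0ℤ , d) ≡ proj₁ w * d
∧-zeroʳ (x , y) d = identity x y d
  where
  identity : ∀ x y d → x * d - 0ℤ * y ≡ x * d
  identity = solve-∀

[i+j]-j≡i : ∀ i j → (i + j) - j ≡ i
[i+j]-j≡i = solve-∀

∣i*j∣≡1⇒∣i∣≡1 : ∀ i j → ∣ i * j ∣ ≡ 1 → ∣ i ∣ ≡ 1
∣i*j∣≡1⇒∣i∣≡1 i j eq = ℕ.m*n≡1⇒m≡1 ∣ i ∣ ∣ j ∣ (trans (sym (ℤ.abs-* i j)) eq)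

∣i*j∣≡1⇒∣j∣≡1 : ∀ i j → ∣ i * j ∣ ≡ 1 → ∣ j ∣ ≡ 1
∣i*j∣≡1⇒∣j∣≡1 i j eq = ℕ.m*n≡1⇒n≡1 ∣ i ∣ ∣ j ∣ (trans (sym (ℤ.abs-* i j)) eq)

∣i∣≡1⇒i≡±1 : ∀ i → ∣ i ∣ ≡ 1 → i ≡ 1ℤ ⊎ i ≡ -1ℤ
∣i∣≡1⇒i≡±1 (+ 1)    _ = inj₁ refl
∣i∣≡1⇒i≡±1 -[1+ 0 ] _ = inj₂ refl

∣i∣≡s*i : ∀ i → Σ ℤ λ s → + ∣ i ∣ ≡ s * i
∣i∣≡s*i (+ n)    = 1ℤ , sym (ℤ.*-identityˡ (+ n))
∣i∣≡s*i -[1+ n ] = -1ℤ , sym (ℤ.-1*i≡-i -[1+ n ])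

∣m∧∤n⇒∤m-n : ∀ {i m n} → i ∣ m → ¬ i ∣ n → ¬ i ∣ m - n
∣m∧∤n⇒∤m-n {i} {m} {n} i∣m i∤n i∣m-n = i∤n (subst (i ∣_) (m-[m-n]≡n m n)
  (Signed.∣⇒∣ᵤ (Signed.∣m∣n⇒∣m-n (Signed.∣ᵤ⇒∣ {i} {m} i∣m) (Signed.∣ᵤ⇒∣ {i} {m - n} i∣m-n))))
  where
  m-[m-n]≡n : ∀ m n → m - (m - n) ≡ n
  m-[m-n]≡n = solve-∀

∤⇒∤- : ∀ {i m} → ¬ i ∣ m → ¬ i ∣ - m
∤⇒∤- {i} {m} i∤m i∣-m = i∤m (subst (ℕ._∣_ ∣ i ∣) (ℤ.∣-i∣≡∣i∣ m) i∣-m)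

+[x*∣i∣]≡[+x*s]*i : ∀ x {i s} → + ∣ i ∣ ≡ s * i → + (x ℕ.* ∣ i ∣) ≡ (+ x * s) * i
+[x*∣i∣]≡[+x*s]*i x {i} {s} ∣i∣≡si = begin
  + (x ℕ.* ∣ i ∣) ≡⟨ ℤ.pos-* x ∣ i ∣ ⟩
  + x * + ∣ i ∣   ≡⟨ cong (+ x *_) ∣i∣≡si ⟩
  + x * (s * i)   ≡⟨ ℤ.*-assoc (+ x) s i ⟨
  (+ x * s) * i   ∎

g+b≡a⇒+g≡+a-+b : ∀ {g a b} → g ℕ.+ b ≡ a → + g ≡ + a - + b
g+b≡a⇒+g≡+a-+b {g} {a} {b} eq = begin
  + g               ≡⟨ [i+j]-j≡i (+ g) (+ b) ⟨
  (+ g + + b) - + b ≡⟨ cong (_- + b) (ℤ.pos-+ g b) ⟨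
  + (g ℕ.+ b) - + b ≡⟨ cong (λ c → + c - + b) eq ⟩
  + a - + b         ∎

bézout : ∀ i j → Σ ℤ λ x → Σ ℤ λ y → x * i + y * j ≡ gcd i j
bézout i j with ∣i∣≡s*i i | ∣i∣≡s*i j | Bézout.identity (gcd-GCD ∣ i ∣ ∣ j ∣)
... | s , ∣i∣≡si | t , ∣j∣≡tj | Bézout.+- x y eq = + x * s , - (+ y * t) , (begin
  (+ x * s) * i + - (+ y * t) * j  ≡⟨ cong (_+_ ((+ x * s) * i)) (sym (ℤ.neg-distribˡ-* (+ y * t) j)) ⟩
  (+ x * s) * i - (+ y * t) * j    ≡⟨ cong₂ _-_ (+[x*∣i∣]≡[+x*s]*i x ∣i∣≡si) (+[x*∣i∣]≡[+x*s]*i y ∣j∣≡tj) ⟨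
  + (x ℕ.* ∣ i ∣) - + (y ℕ.* ∣ j ∣) ≡⟨ g+b≡a⇒+g≡+a-+b eq ⟨
  gcd i j                          ∎)
... | s , ∣i∣≡si | t , ∣j∣≡tj | Bézout.-+ x y eq = - (+ x * s) , + y * t , (begin
  - (+ x * s) * i + (+ y * t) * j  ≡⟨ swap (+ x * s) i ((+ y * t) * j) ⟩
  (+ y * t) * j - (+ x * s) * i    ≡⟨ cong₂ _-_ (+[x*∣i∣]≡[+x*s]*i y ∣j∣≡tj) (+[x*∣i∣]≡[+x*s]*i x ∣i∣≡si) ⟨
  + (y ℕ.* ∣ j ∣) - + (x ℕ.* ∣ i ∣) ≡⟨ g+b≡a⇒+g≡+a-+b eq ⟨
  gcd i j                          ∎)
  where
  swap : ∀ a i c → (- a) * i + c ≡ c - a * i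
  swap = solve-∀

Unimodular : ℤ² → Set
Unimodular v = Σ ℤ² λ u → u ∧ v ≡ 1ℤ

primitive⇒unimodular : ∀ v → Primitive v → Unimodular v
primitive⇒unimodular (b , d) gcd≡1 with bézout b d
... | x , y , xb+yd≡gcd = (y , - x) , (begin
  y * d - b * (- x) ≡⟨ rearrange x y b d ⟩
  x * b + y * d     ≡⟨ xb+yd≡gcd ⟩
  gcd b d           ≡⟨ gcd≡1 ⟩
  1ℤ                ∎)
  where
  rearrange : ∀ x y b d → y * d - b * (- x) ≡ x * b + y * d
  rearrange = solve-∀

_∤₂_ : ℤ → ℤ² → Set
m ∤₂ v = ¬ m ∣ proj₂ v

Predecessor : (ℤ² → Set) → ℤ² → Set
Predecessor P v = Σ ℤ² λ w → w ∧ v ≡ 1ℤ × P w × ∣ proj₁ w ∣ < ∣ proj₁ v ∣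

0<m<n⇒∣m-n∣<n : ∀ {m n} → 0 < m → m < n → ∣ + m - + n ∣ < n
0<m<n⇒∣m-n∣<n {m} {n} 0<m m<n = subst (_< n) ∣m-n∣≡n∸m (ℕ.∸-monoʳ-< {n} {m} {0} 0<m (ℕ.<⇒≤ m<n))
  where
  ∣m-n∣≡n∸m : n ∸ m ≡ ∣ + m - + n ∣
  ∣m-n∣≡n∸m = trans (sym (ℤ.∣⊖∣-< m<n)) (cong ∣_∣ (sym (ℤ.m-n≡m⊖n m n)))

predecessor-of-positive : ∀ m n d → 2 ≤ n → ¬ m ∣ d → Unimodular (+ n , d) →
                          Predecessor (m ∤₂_) (+ n , d)
predecessor-of-positive m n@(suc (suc _)) d (s≤s (s≤s _)) m∤d ((p , q) , u∧v≡1) =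
  choose (ℕ._∣?_ ∣ m ∣ ∣ e ∣)
  where
  v = (+ n , d)
  k = p /ℕ n
  r = p %ℕ n
  e = q - k * d

  p-kn≡r : p - k * + n ≡ + r
  p-kn≡r = begin
    p - k * + n               ≡⟨ cong (_- k * + n) (a≡a%ℕn+[a/ℕn]*n p n) ⟩
    (+ r + k * + n) - k * + n ≡⟨ [i+j]-j≡i (+ r) (k * + n) ⟩
    + r                       ∎

  reduced : (+ r , e) ∧ v ≡ 1ℤ
  reduced = subst (λ x → (x , e) ∧ v ≡ 1ℤ) p-kn≡r (trans (∧-sub-multiple (p , q) k v) u∧v≡1)

  r<n : r < n
  r<n = n%ℕd<d p n

  -- If r = 0 then (0 , e) ∧ (n , d) = - n e = 1 forces n = 1.
  0<r : 0 < r
  0<r = ℕ.n≢0⇒n>0 r≢0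
    where
    r≢0 : r ≡ 0 → ⊥
    r≢0 r≡0 with ∣i*j∣≡1⇒∣i∣≡1 (+ n) e (trans (sym (ℤ.∣-i∣≡∣i∣ (+ n * e)))
                   (cong ∣_∣ (trans (sym (∧-zeroˡ e v)) (subst (λ x → (+ x , e) ∧ v ≡ 1ℤ) r≡0 reduced))))
    ... | ()

  choose : Dec (m ∣ e) → Predecessor (m ∤₂_) v
  choose (no m∤e)  = (+ r , e) , reduced , m∤e , r<n
  choose (yes m∣e) = (+ r , e) -[ 1ℤ ] v , trans (∧-sub-multiple (+ r , e) 1ℤ v) reduced
                   , ∣m∧∤n⇒∤m-n {m} {e} {1ℤ * d} m∣e (m∤d ∘ subst (m ∣_) (ℤ.*-identityˡ d))
                   , subst (λ x → ∣ + r - x ∣ < n) (sym (ℤ.*-identityˡ (+ n))) (0<m<n⇒∣m-n∣<n 0<r r<n)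

predecessor : ∀ m v → 2 ≤ ∣ proj₁ v ∣ → m ∤₂ v → Unimodular v → Predecessor (m ∤₂_) v
predecessor m (+ n , d) = predecessor-of-positive m n d
predecessor m v@(-[1+ n ] , d) 2≤n m∤d (u , u∧v≡1)
  with predecessor-of-positive m (suc n) (- d) 2≤n (∤⇒∤- {m} {d} m∤d)
                               (negate u , trans (negate-∧-negate u v) u∧v≡1)
... | w , w∧-v≡1 , m∤w , smaller =
  negate w , trans (negate-∧ w v) w∧-v≡1 , ∤⇒∤- {m} {proj₂ w} m∤w ,
  subst (_< suc n) (sym (ℤ.∣-i∣≡∣i∣ (proj₁ w))) smaller

Step : (ℤ² → Set) → ℤ² → ℤ² → Set
Step P v w = v ∧ w ≡ 1ℤ × P w

Sequence : (ℤ² → Set) → ℤ² → ℤ² → Set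
Sequence P a b = Σ ℕ λ k → Σ (Fin (suc k) → ℤ²) λ v →
  (v zero ≡ a) × (v (fromℕ k) ≡ b)
  × ((i : Fin k) → v (inject₁ i) ∧ v (Data.Fin.suc i) ≡ 1ℤ)
  × ((i : Fin (suc k)) → P (v i))

star⇒sequence : ∀ {P a b} → P a → Star (Step P) a b → Sequence P a b
star⇒sequence {a = a} Pa ε = 0 , (λ _ → a) , refl , refl , (λ ()) , (λ _ → Pa)
star⇒sequence {P} {a} Pa ((a∧w≡1 , Pw) ◅ rest) with star⇒sequence Pw rest
... | k , v , v₀≡w , vₖ≡b , steps , valid = suc k , a ∷ v , refl , vₖ≡b , steps′ , valid′
  where
  steps′ : (i : Fin (suc k)) → (a ∷ v) (inject₁ i) ∧ (a ∷ v) (Data.Fin.suc i) ≡ 1ℤ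
  steps′ zero             = subst (λ w → a ∧ w ≡ 1ℤ) (sym v₀≡w) a∧w≡1
  steps′ (Data.Fin.suc i) = steps i

  valid′ : (i : Fin (suc (suc k))) → P ((a ∷ v) i)
  valid′ zero             = Pa
  valid′ (Data.Fin.suc i) = valid i

module _ (N : ℕ) (2≤N : 2 ≤ N) where

  private
    P : ℤ² → Set
    P = _∤₂_ (+ N)

  N∤1 : ¬ N ℕ.∣ 1
  N∤1 N∣1 = ℕ.<⇒≢ 2≤N (sym (ℕ.∣1⇒≡1 N∣1))

  Reachable : ℤ² → Set
  Reachable v = Unimodular v → P v → Star (Step P) (0ℤ , 1ℤ) v

  reach-0,-1 : Star (Step P) (0ℤ , 1ℤ) (0ℤ , -1ℤ)
  reach-0,-1 = _◅_ {j = -1ℤ , 1ℤ} (refl , N∤1) ((refl , N∤1) ◅ ε)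

  reach-via : ∀ {v} → Predecessor P v → (∀ {w} → ∣ proj₁ w ∣ < ∣ proj₁ v ∣ → Reachable w) → P v →
              Star (Step P) (0ℤ , 1ℤ) v
  reach-via {v} (w , w∧v≡1 , Pw , smaller) reach Pv =
    reach {w} smaller (negate v , trans (negate-∧-swap v w) w∧v≡1) Pw ◅◅ ((w∧v≡1 , Pv) ◅ ε)

  reachable-step : ∀ v → (∀ {w} → ∣ proj₁ w ∣ < ∣ proj₁ v ∣ → Reachable w) → Reachable v
  reachable-step (+ 0 , d) _ (u , u∧v≡1) Pv
    with ∣i∣≡1⇒i≡±1 d (∣i*j∣≡1⇒∣j∣≡1 (proj₁ u) d (cong ∣_∣ (trans (sym (∧-zeroʳ u d)) u∧v≡1)))
  ... | inj₁ refl = ε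
  ... | inj₂ refl = reach-0,-1
  reachable-step (+ 1 , d) _ _ Pv = reach-0,-1 ◅◅ ((refl , Pv) ◅ ε)
  reachable-step (-[1+ 0 ] , d) _ _ Pv = (refl , Pv) ◅ ε
  reachable-step v@(+ suc (suc _) , _) reach Uv Pv =
    reach-via (predecessor (+ N) v (s≤s (s≤s z≤n)) Pv Uv) reach Pv
  reachable-step v@(-[1+ suc _ ] , _) reach Uv Pv =
    reach-via (predecessor (+ N) v (s≤s (s≤s z≤n)) Pv Uv) reach Pv

  reachable : ∀ v → Reachable v
  reachable = All.wfRec (On.wellFounded (∣_∣ ∘ proj₁) <-wellFounded) _ Reachable reachable-step

lemma4p7 : (N : ℕ) → 2 ≤ N → (b d : ℤ) → Primitive (b , d) → ¬ ((+ N) ∣ d) →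
    Σ ℕ λ k → Σ (Fin (suc k) → ℤ²) λ v →
    (v zero ≡ (0ℤ , 1ℤ)) × (v (fromℕ k) ≡ (b , d))
    × ((i : Fin k) → v (inject₁ i) ∧ v (Data.Fin.suc i) ≡ 1ℤ)
    × ((i : Fin (suc k)) → ¬ ((+ N) ∣ proj₂ (v i)))
lemma4p7 N 2≤N b d prim N∤d =
  star⇒sequence (N∤1 N 2≤N) (reachable N 2≤N (b , d) (primitive⇒unimodular (b , d) prim) N∤d)
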